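{- For all $n\geqslant 0$ and all integers $k$, $$\widehat{B}(n+1,k)=(k+1)\widehat{B}(n,k+1)+k\widehat{B}(n,k-1)+(n-k+1)\widehat{B}(n,k)+(n-k+2)\widehat{B}(n,k-2),$$ where $\widehat B(n,k)=0$ for $k<0$ or $k>n$; here $\widehat{B}(1,0)=\widehat{B}(1,1)=1$. Equivalently, for $n\geqslant 0$, $$\widehat{B}_{n+1}(x)=(1+n+x+nx^2)\widehat{B}_{n}(x)+(1-x)(1+x^2)\frac{\mathrm{d}}{\mathrm{d}x}\widehat{B}_{n}(x),$$ with $\widehat{B}_{0}(x)=1$, $\widehat{B}_{1}(x)=1+x$.
   Context: Let $\mathcal{S}^B_n$ be the set of signed permutations $\sigma$ of $\{\pm1,\dots,\pm n\}$ with $\sigma(-i)=-\sigma(i)$, written as $\sigma(0)\sigma(1)\cdots\sigma(n)$ with $\sigma(0)=0$. A position $j\in\{0,\dots,n-1\}$ is an alternating descent of $\sigma$ if $j$ is even and $\sigma(j)<\sigma(j+1)$, or $j$ is odd and $\sigma(j)>\sigma(j+1)$; ${\rm altdes}_B(\sigma)$ is their number. $\widehat{B}(n,k)=\#\{\sigma\in\mathcal{S}^B_n:{\rm altdes}_B(\sigma)=k\}$ and $\widehat{B}_n(x)=\sum_k\widehat{B}(n,k)x^k$, $\widehat B_0(x)=1$. -}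

module Defs where

open import Data.Bool using (Bool; true; false; _∧_; not; if_then_else_)
open import Data.Nat using (ℕ; zero; suc; _≡ᵇ_; _≤ᵇ_)
open import Data.Integer using (ℤ; +_; -_; _<_; ∣_∣; _+_)
open import Data.Integer.Properties using (_<?_; _≟_)
open import Data.List using (List; []; _∷_; map; concatMap; filter; length; downFrom; reverse; _++_)
open import Data.Bool.ListAction using (all; any)
open import Relation.Nullary.Decidable using (⌊_⌋)
open import Relation.Binary.PropositionalEquality using (_≡_)
open import Data.Product using (_×_)

range : ℕ → List ℤ
range n = map (λ i → - (+ i)) (downFrom (suc n)) ++ map (λ i → + (suc i)) (reverse (downFrom n))

words : List ℤ → ℕ → List (List ℤ)
words xs zero = [] ∷ []
words xs (suc len) = concatMap (λ x → map (x ∷_) (words xs len)) xs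

distinct : List ℕ → Bool
distinct [] = true
distinct (x ∷ xs) = not (any (λ y → x ≡ᵇ y) xs) ∧ distinct xs

-- w = σ(1) … σ(n) is (the one-line notation of) a signed permutation of {±1,…,±n}:
-- length n, each |σ(i)| ∈ {1,…,n}, and the |σ(i)| pairwise distinct.
isSignedPerm : ℕ → List ℤ → Bool
isSignedPerm n w =
  (length w ≡ᵇ n) ∧ all (λ x → (1 ≤ᵇ ∣ x ∣) ∧ (∣ x ∣ ≤ᵇ n)) w ∧ distinct (map ∣_∣ w)

signedPerms : ℕ → List (List ℤ)
signedPerms n = filter (λ w → Data.Bool._≟_ (isSignedPerm n w) true) (words (range n) n)

-- altdesAux j prev rest: number of alternating descents at positions j, j+1, …
-- where prev = σ(j) and rest = σ(j+1) σ(j+2) …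
-- parity flag 'even' tells whether j is even.
altdesAux : Bool → ℤ → List ℤ → ℕ
altdesAux even prev [] = zero
altdesAux true prev (x ∷ xs) =
  (if ⌊ prev <? x ⌋ then suc else (λ m → m)) (altdesAux false x xs)
altdesAux false prev (x ∷ xs) =
  (if ⌊ x <? prev ⌋ then suc else (λ m → m)) (altdesAux true x xs)

-- altdes_B(σ) for σ = σ(1)…σ(n), with σ(0) = 0 prepended (position 0 is even)
altdesB : List ℤ → ℕ
altdesB w = altdesAux true (+ 0) w

Bhat : ℕ → ℤ → ℤ
Bhat n k = + length (filter (λ w → (+ altdesB w) ≟ k) (signedPerms n))

-- Negating the entries of σ in odd positions is a bijection of S^B_n that turns altdes_B(σ)
-- into the number of adjacent pairs (σ(j), σ(j+1)), 0 ≤ j < n, with negative sum.  Every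
-- signed permutation of n+1 arises exactly once by inserting n+1 or -(n+1) into one of the
-- n+1 gaps of a signed permutation u of n; say u has d negative pairs.  Both new pairs are
-- nonnegative for +(n+1) and negative for -(n+1), while the pair the gap falls in is
-- destroyed, and that pair is negative for exactly d of the n interior gaps.  So +(n+1)
-- produces d permutations with d-1 negative pairs and n+1-d with d, and -(n+1) produces d+1
-- with d+1 (the last gap included) and n-d with d+2.  Summing over u gives the recurrence.
module Submission where

open import Defs
open import Data.Bool using (Bool; true; false; not; T; if_then_else_; _∧_)
  renaming (_≟_ to _≟ᵇ_)
open import Data.Bool.Properties using (T-∧; T-≡)
open import Data.Bool.ListAction using (all; any)
open import Data.Empty using (⊥-elim)
open import Data.Nat as ℕ using (ℕ; zero; suc; z≤n; s≤s; _≡ᵇ_; _≤ᵇ_)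
import Data.Nat.Properties as ℕₚ
open import Data.Integer as ℤ using (ℤ; +_; -_; _+_; _-_; _*_; ∣_∣; +[1+_]; -[1+_]; _<_)
import Data.Integer.Properties as ℤₚ
open import Data.Integer.Properties using (_≟_; _<?_)
open import Data.Integer.Tactic.RingSolver using (solve-∀)
open import Data.List
  using (List; []; _∷_; _++_; map; concatMap; filter; length; downFrom; reverse)
import Data.List.Properties as Listₚ
open import Data.List.Membership.Propositional using (_∈_; _∉_; find)
open import Data.List.Membership.Propositional.Properties
  using ( ∈-map⁺; ∈-map⁻; ∈-++⁺ˡ; ∈-++⁺ʳ; ∈-++⁻; ∈-concatMap⁺; ∈-concatMap⁻
        ; ∈-filter⁺; ∈-filter⁻; ∈-∃++; ∈-downFrom⁺)
open import Data.List.Membership.Propositional.Properties.WithK using (unique∧set⇒bag)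
open import Data.List.Relation.Binary.BagAndSetEquality using (∼bag⇒↭)
open import Data.List.Relation.Binary.Disjoint.Propositional using (Disjoint)
open import Data.List.Relation.Binary.Permutation.Propositional using (_↭_; ↭-sym; ↭⇒↭ₛ)
open import Data.List.Relation.Binary.Permutation.Propositional.Properties
  using (↭-length; ↭-reverse; shift; ∈-resp-↭; All-resp-↭; filter-↭)
import Data.List.Relation.Binary.Permutation.Propositional.Properties as ↭ₚ
import Data.List.Relation.Binary.Permutation.Setoid.Properties as ↭ₛ
open import Data.List.Relation.Unary.All as All using (All; []; _∷_)
open import Data.List.Relation.Unary.All.Properties as Allₚ
  using (all⁺; all⁻; ¬Any⇒All¬; All¬⇒¬Any)
open import Data.List.Relation.Unary.AllPairs using ([]; _∷_)
open import Data.List.Relation.Unary.Any as Any using (Any; here; there)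
open import Data.List.Relation.Unary.Any.Properties using (any⁺; any⁻)
open import Data.List.Relation.Unary.Unique.Propositional using (Unique)
import Data.List.Relation.Unary.Unique.Propositional.Properties as Uniqueₚ
open import Data.Product using (_×_; _,_; proj₁; proj₂; ∃; ∃₂; curry)
open import Data.Sum using (_⊎_; inj₁; inj₂)
open import Function using (_∘_; _⇔_; mk⇔; Equivalence)
open import Relation.Nullary using (¬_; yes; no)
open import Relation.Nullary.Decidable using (⌊_⌋; does-⇔; isYes≗does)
open import Relation.Binary.PropositionalEquality
  using (_≡_; _≢_; refl; sym; trans; cong; cong₂; subst; subst₂; setoid; module ≡-Reasoning)

open ≡-Reasoning

unique-resp-↭ : ∀ {A : Set} {xs ys : List A} → xs ↭ ys → Unique xs → Unique ys
unique-resp-↭ {A} xs↭ys = ↭ₛ.Unique-resp-↭ (setoid A) (↭⇒↭ₛ xs↭ys)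

unique∧set⇒↭ : ∀ {A : Set} {xs ys : List A} → Unique xs → Unique ys →
  (∀ {x} → x ∈ xs → x ∈ ys) → (∀ {x} → x ∈ ys → x ∈ xs) → xs ↭ ys
unique∧set⇒↭ xs! ys! to from = ∼bag⇒↭ (unique∧set⇒bag xs! ys! (mk⇔ to from))

unique-concatMap : ∀ {A B : Set} (f : A → List B) (g : B → A) {xs} → Unique xs →
  (∀ {x} → x ∈ xs → Unique (f x)) → (∀ {x y} → x ∈ xs → y ∈ f x → g y ≡ x) →
  Unique (concatMap f xs)
unique-concatMap f g {[]}     []          _      _     = []
unique-concatMap f g {x ∷ xs} (x∉ ∷ xs!) f-uniq g-inv = Uniqueₚ.++⁺
  (f-uniq (here refl)) (unique-concatMap f g xs! (f-uniq ∘ there) (g-inv ∘ there)) disjoint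
  where
  disjoint : Disjoint (f x) (concatMap f xs)
  disjoint (y∈fx , y∈rest) with find (∈-concatMap⁻ f {xs = xs} y∈rest)
  ... | x′ , x′∈xs , y∈fx′ =
    All.lookup x∉ x′∈xs (trans (sym (g-inv (here refl) y∈fx)) (g-inv (there x′∈xs) y∈fx′))

InRange : ℕ → ℕ → Set
InRange n a = 1 ℕ.≤ a × a ℕ.≤ n

All-inRange-pred : ∀ {n as} → All (InRange (suc n)) as → All (suc n ≢_) as → All (InRange n) as
All-inRange-pred = curry (All.zipWith λ ((1≤a , a≤1+n) , 1+n≢a) →
  1≤a , ℕₚ.≤-pred (ℕₚ.≤∧≢⇒< a≤1+n (1+n≢a ∘ sym)))

unique∧bounded⇒length≤ : ∀ m {as} → Unique as → All (InRange m) as → length as ℕ.≤ m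
unique∧bounded⇒length≤ zero    {[]}    _ _                 = z≤n
unique∧bounded⇒length≤ zero    {_ ∷ _} _ ((1≤a , a≤0) ∷ _) with () ← ℕₚ.≤-trans 1≤a a≤0
unique∧bounded⇒length≤ (suc m) {as} as! as∈ with Any.any? (suc m ℕ.≟_) as
... | no 1+m∉as =
  ℕₚ.m≤n⇒m≤1+n (unique∧bounded⇒length≤ m as! (All-inRange-pred as∈ (¬Any⇒All¬ as 1+m∉as)))
... | yes 1+m∈as with bs , cs , refl ← ∈-∃++ 1+m∈as
  with fresh ∷ rest! ← unique-resp-↭ (shift (suc m) bs cs) as!
  with _ ∷ rest∈ ← All-resp-↭ (shift (suc m) bs cs) as∈ =
  subst (ℕ._≤ suc m) (sym (↭-length (shift (suc m) bs cs)))
    (s≤s (unique∧bounded⇒length≤ m rest! (All-inRange-pred rest∈ fresh)))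

SignedPerm : ℕ → List ℤ → Set
SignedPerm n w = length w ≡ n × All (InRange n) (map ∣_∣ w) × Unique (map ∣_∣ w)

signedPerm-small : ∀ {n u} → SignedPerm n u → All (λ x → ∣ x ∣ ℕ.≤ n) u
signedPerm-small (_ , u∈ , _) = All.map proj₂ (Allₚ.map⁻ u∈)

large∉signedPerm : ∀ {n u v} → SignedPerm n u → ∣ v ∣ ≡ suc n → v ∉ u
large∉signedPerm {n} sp ∣v∣≡1+n v∈u =
  ℕₚ.<-irrefl refl (subst (ℕ._≤ n) ∣v∣≡1+n (All.lookup (signedPerm-small sp) v∈u))

signedPerm-resp-↭ : ∀ {n w w′} → w ↭ w′ → SignedPerm n w → SignedPerm n w′
signedPerm-resp-↭ w↭w′ (len , w∈ , w!) =
  trans (sym (↭-length w↭w′)) len , All-resp-↭ ∣w∣↭∣w′∣ w∈ , unique-resp-↭ ∣w∣↭∣w′∣ w!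
  where ∣w∣↭∣w′∣ = ↭ₚ.map⁺ ∣_∣ w↭w′

signedPerm-∷⁺ : ∀ {n v u} → ∣ v ∣ ≡ suc n → SignedPerm n u → SignedPerm (suc n) (v ∷ u)
signedPerm-∷⁺ {n} {v} ∣v∣≡1+n (len , u∈ , u!) =
  cong suc len ,
  subst (InRange (suc n)) (sym ∣v∣≡1+n) (s≤s z≤n , ℕₚ.≤-refl) ∷ All.map weaken u∈ ,
  All.map (λ (_ , a≤n) → ∣v∣≢ a≤n) u∈ ∷ u!
  where
  weaken : ∀ {a} → InRange n a → InRange (suc n) a
  weaken (1≤a , a≤n) = 1≤a , ℕₚ.m≤n⇒m≤1+n a≤n
  ∣v∣≢ : ∀ {a} → a ℕ.≤ n → ∣ v ∣ ≢ a
  ∣v∣≢ a≤n ∣v∣≡a = ℕₚ.<-irrefl refl (subst (ℕ._≤ n) (trans (sym ∣v∣≡a) ∣v∣≡1+n) a≤n)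

signedPerm-∷⁻ : ∀ {n v u} → ∣ v ∣ ≡ suc n → SignedPerm (suc n) (v ∷ u) → SignedPerm n u
signedPerm-∷⁻ ∣v∣≡1+n (len , _ ∷ u∈ , v-fresh ∷ u!) =
  ℕₚ.suc-injective len ,
  All-inRange-pred u∈ (All.map (λ ∣v∣≢a → ∣v∣≢a ∘ trans ∣v∣≡1+n) v-fresh) ,
  u!

signedPerm-max : ∀ {n w} → SignedPerm (suc n) w → Any (λ v → ∣ v ∣ ≡ suc n) w
signedPerm-max {n} {w} (len , w∈ , w!) with Any.any? (λ v → ∣ v ∣ ℕ.≟ suc n) w
... | yes found = found
... | no ¬found = ⊥-elim (ℕₚ.<-irrefl refl (subst (ℕ._≤ n) (trans (Listₚ.length-map ∣_∣ w) len)
                    (unique∧bounded⇒length≤ n w! (All-inRange-pred w∈ small))))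
  where
  small : All (suc n ≢_) (map ∣_∣ w)
  small = Allₚ.map⁺ (All.map (_∘ sym) (¬Any⇒All¬ w ¬found))

T-not : ∀ {b} → T (not b) ⇔ (¬ T b)
T-not {true}  = mk⇔ (λ ()) (λ ¬t → ¬t _)
T-not {false} = mk⇔ (λ _ ()) (λ _ → _)

fresh⁻ : ∀ x ys → T (not (any (x ≡ᵇ_) ys)) → All (x ≢_) ys
fresh⁻ x ys t = All.map (λ ¬x≡ᵇy x≡y → ¬x≡ᵇy (ℕₚ.≡⇒≡ᵇ x _ x≡y))
  (¬Any⇒All¬ ys (Equivalence.to T-not t ∘ any⁺ _))

fresh⁺ : ∀ x ys → All (x ≢_) ys → T (not (any (x ≡ᵇ_) ys))
fresh⁺ x ys x∉ys = Equivalence.from T-not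
  (All¬⇒¬Any (All.map (λ x≢y → x≢y ∘ ℕₚ.≡ᵇ⇒≡ x _) x∉ys) ∘ any⁻ _ ys)

distinct⁻ : ∀ xs → T (distinct xs) → Unique xs
distinct⁻ []       _ = []
distinct⁻ (x ∷ xs) t = let (t₁ , t₂) = Equivalence.to T-∧ t in fresh⁻ x xs t₁ ∷ distinct⁻ xs t₂

distinct⁺ : ∀ {xs} → Unique xs → T (distinct xs)
distinct⁺ []         = _
distinct⁺ (x∉ ∷ xs!) = Equivalence.from T-∧ (fresh⁺ _ _ x∉ , distinct⁺ xs!)

inRangeᵇ : ℕ → ℤ → Bool
inRangeᵇ n x = (1 ≤ᵇ ∣ x ∣) ∧ (∣ x ∣ ≤ᵇ n)

isSignedPerm⁻ : ∀ n w → T (isSignedPerm n w) → SignedPerm n w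
isSignedPerm⁻ n w t
  with t₁ , t₂₃ ← Equivalence.to (T-∧ {length w ≡ᵇ n}) t
  with t₂ , t₃ ← Equivalence.to (T-∧ {all (inRangeᵇ n) w}) t₂₃
  = ℕₚ.≡ᵇ⇒≡ _ _ t₁ , Allₚ.map⁺ (All.map (λ {x} → inRange⁻ {x}) (all⁺ _ w t₂)) , distinct⁻ _ t₃
  where
  inRange⁻ : ∀ {x} → T (inRangeᵇ n x) → InRange n ∣ x ∣
  inRange⁻ r = let (r₁ , r₂) = Equivalence.to T-∧ r in ℕₚ.≤ᵇ⇒≤ 1 _ r₁ , ℕₚ.≤ᵇ⇒≤ _ n r₂

isSignedPerm⁺ : ∀ n w → SignedPerm n w → T (isSignedPerm n w)
isSignedPerm⁺ n w (len , w∈ , w!) = Equivalence.from (T-∧ {length w ≡ᵇ n})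
  ( ℕₚ.≡⇒≡ᵇ _ _ len
  , Equivalence.from (T-∧ {all (inRangeᵇ n) w})
      (all⁻ (inRangeᵇ n) (All.map (λ {x} → inRange⁺ {x}) (Allₚ.map⁻ w∈)) , distinct⁺ w!))
  where
  inRange⁺ : ∀ {x} → InRange n ∣ x ∣ → T (inRangeᵇ n x)
  inRange⁺ (1≤a , a≤n) = Equivalence.from T-∧ (ℕₚ.≤⇒≤ᵇ 1≤a , ℕₚ.≤⇒≤ᵇ a≤n)

∈-range⁺ : ∀ n {x} → InRange n ∣ x ∣ → x ∈ range n
∈-range⁺ n {+ zero}    (() , _)
∈-range⁺ n {+[1+ m ]}  (_ , m<n) = ∈-++⁺ʳ _
  (∈-map⁺ (+_ ∘ suc) (∈-resp-↭ (↭-sym (↭-reverse (downFrom n))) (∈-downFrom⁺ m<n)))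
∈-range⁺ n { -[1+ m ]} (_ , m<n) = ∈-++⁺ˡ (∈-map⁺ (-_ ∘ +_) (∈-downFrom⁺ (s≤s m<n)))

unique-range : ∀ n → Unique (range n)
unique-range n = Uniqueₚ.++⁺
  (Uniqueₚ.map⁺ (ℤₚ.+-injective ∘ ℤₚ.neg-injective) (Uniqueₚ.downFrom⁺ (suc n)))
  (Uniqueₚ.map⁺ (ℕₚ.suc-injective ∘ ℤₚ.+-injective)
    (unique-resp-↭ (↭-sym (↭-reverse (downFrom n))) (Uniqueₚ.downFrom⁺ n)))
  disjoint
  where
  disjoint : Disjoint (map (-_ ∘ +_) (downFrom (suc n))) (map (+_ ∘ suc) (reverse (downFrom n)))
  disjoint (x∈⁻ , x∈⁺) with ∈-map⁻ (-_ ∘ +_) x∈⁻ | ∈-map⁻ (+_ ∘ suc) x∈⁺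
  ... | zero  , _ , refl | _ , _ , ()
  ... | suc _ , _ , refl | _ , _ , ()

∈-words⁺ : ∀ xs len {w} → length w ≡ len → All (_∈ xs) w → w ∈ words xs len
∈-words⁺ xs zero      {[]}    refl []          = here refl
∈-words⁺ xs (suc len) {y ∷ w} refl (y∈xs ∷ w∈) = ∈-concatMap⁺ (λ x → map (x ∷_) (words xs len))
  (Any.map (λ { refl → ∈-map⁺ (y ∷_) (∈-words⁺ xs len refl w∈) }) y∈xs)

unique-words : ∀ xs len → Unique xs → Unique (words xs len)
unique-words xs zero      _   = [] ∷ []
unique-words xs (suc len) xs! = unique-concatMap (λ x → map (x ∷_) (words xs len)) head xs!
  (λ _ → Uniqueₚ.map⁺ (proj₂ ∘ Listₚ.∷-injective) (unique-words xs len xs!))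
  (λ _ y∈ → let (_ , _ , y≡) = ∈-map⁻ _ y∈ in cong head y≡)
  where
  head : List ℤ → ℤ
  head []      = + 0
  head (x ∷ _) = x

∈-signedPerms⁺ : ∀ n {w} → SignedPerm n w → w ∈ signedPerms n
∈-signedPerms⁺ n {w} sp@(len , w∈ , _) = ∈-filter⁺ (λ w → isSignedPerm n w ≟ᵇ true)
  (∈-words⁺ (range n) n len (All.map (∈-range⁺ n) (Allₚ.map⁻ w∈)))
  (Equivalence.to T-≡ (isSignedPerm⁺ n w sp))

∈-signedPerms⁻ : ∀ n {w} → w ∈ signedPerms n → SignedPerm n w
∈-signedPerms⁻ n {w} w∈ = isSignedPerm⁻ n w (Equivalence.from T-≡
  (proj₂ (∈-filter⁻ (λ w → isSignedPerm n w ≟ᵇ true) {xs = words (range n) n} w∈)))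

unique-signedPerms : ∀ n → Unique (signedPerms n)
unique-signedPerms n = Uniqueₚ.filter⁺ _ (unique-words (range n) n (unique-range n))

-- Signed permutations by insertion

insertions : ℤ → List ℤ → List (List ℤ)
insertions v []       = (v ∷ []) ∷ []
insertions v (x ∷ xs) = (v ∷ x ∷ xs) ∷ map (x ∷_) (insertions v xs)

∈-insertions⁺ : ∀ v as bs → as ++ v ∷ bs ∈ insertions v (as ++ bs)
∈-insertions⁺ v []       []      = here refl
∈-insertions⁺ v []       (_ ∷ _) = here refl
∈-insertions⁺ v (a ∷ as) bs      = there (∈-map⁺ (a ∷_) (∈-insertions⁺ v as bs))

∈-insertions⁻ : ∀ v u {w} → w ∈ insertions v u →
  ∃₂ λ as bs → u ≡ as ++ bs × w ≡ as ++ v ∷ bs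
∈-insertions⁻ v []       (here refl) = [] , [] , refl , refl
∈-insertions⁻ v (x ∷ xs) (here refl) = [] , x ∷ xs , refl , refl
∈-insertions⁻ v (x ∷ xs) (there w∈)
  with w′ , w′∈ , refl ← ∈-map⁻ (x ∷_) w∈
  with as , bs , refl , refl ← ∈-insertions⁻ v xs w′∈ = x ∷ as , bs , refl , refl

∈-insertions⇒↭ : ∀ v u {w} → w ∈ insertions v u → w ↭ v ∷ u
∈-insertions⇒↭ v u w∈ with as , bs , refl , refl ← ∈-insertions⁻ v u w∈ = shift v as bs

unique-insertions : ∀ v u → v ∉ u → Unique (insertions v u)
unique-insertions v []       _   = [] ∷ []
unique-insertions v (x ∷ xs) v∉ = All.tabulate head-differs
  ∷ Uniqueₚ.map⁺ (proj₂ ∘ Listₚ.∷-injective) (unique-insertions v xs (v∉ ∘ there))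
  where
  head-differs : ∀ {w} → w ∈ map (x ∷_) (insertions v xs) → v ∷ x ∷ xs ≢ w
  head-differs w∈ v∷x∷xs≡w with _ , _ , refl ← ∈-map⁻ (x ∷_) w∈ =
    v∉ (here (proj₁ (Listₚ.∷-injective v∷x∷xs≡w)))

dropLarge : ℕ → List ℤ → List ℤ
dropLarge n = filter (λ x → ∣ x ∣ ℕ.≤? n)

dropLarge-insertions : ∀ n v u {w} → All (λ x → ∣ x ∣ ℕ.≤ n) u → n ℕ.< ∣ v ∣ →
  w ∈ insertions v u → dropLarge n w ≡ u
dropLarge-insertions n v u small n<∣v∣ w∈ with as , bs , refl , refl ← ∈-insertions⁻ v u w∈ =
  begin
    dropLarge n (as ++ v ∷ bs)
      ≡⟨ Listₚ.filter-++ small? as (v ∷ bs) ⟩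
    dropLarge n as ++ dropLarge n (v ∷ bs)
      ≡⟨ cong (dropLarge n as ++_) (Listₚ.filter-reject small? {x = v} {xs = bs} (ℕₚ.<⇒≱ n<∣v∣)) ⟩
    dropLarge n as ++ dropLarge n bs
      ≡⟨ cong₂ _++_ (Listₚ.filter-all small? (Allₚ.++⁻ˡ as small))
                    (Listₚ.filter-all small? (Allₚ.++⁻ʳ as small)) ⟩
    as ++ bs
  ∎
  where small? = λ x → ∣ x ∣ ℕ.≤? n

extend : ℕ → List ℤ → List (List ℤ)
extend n u = insertions +[1+ n ] u ++ insertions -[1+ n ] u

∈-extend⁺ : ∀ n {v} as bs → ∣ v ∣ ≡ suc n → as ++ v ∷ bs ∈ extend n (as ++ bs)
∈-extend⁺ n {+ _}       as bs refl = ∈-++⁺ˡ (∈-insertions⁺ _ as bs)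
∈-extend⁺ n { -[1+ _ ]} as bs refl = ∈-++⁺ʳ _ (∈-insertions⁺ _ as bs)

∈-extend⁻ : ∀ n u {w} → w ∈ extend n u → ∃ λ v → ∣ v ∣ ≡ suc n × w ↭ v ∷ u
∈-extend⁻ n u w∈ with ∈-++⁻ (insertions +[1+ n ] u) w∈
... | inj₁ w∈⁺ = +[1+ n ] , refl , ∈-insertions⇒↭ _ u w∈⁺
... | inj₂ w∈⁻ = -[1+ n ] , refl , ∈-insertions⇒↭ _ u w∈⁻

unique-extend : ∀ {n u} → SignedPerm n u → Unique (extend n u)
unique-extend {n} {u} sp = Uniqueₚ.++⁺
  (unique-insertions _ u (large∉signedPerm sp refl))
  (unique-insertions _ u (large∉signedPerm sp refl))
  disjoint
  where
  disjoint : Disjoint (insertions +[1+ n ] u) (insertions -[1+ n ] u)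
  disjoint (w∈⁺ , w∈⁻)
    with there v∈u ← ∈-resp-↭ (∈-insertions⇒↭ _ u w∈⁺)
                       (∈-resp-↭ (↭-sym (∈-insertions⇒↭ _ u w∈⁻)) (here refl))
    = large∉signedPerm sp refl v∈u

dropLarge-extend : ∀ {n u w} → SignedPerm n u → w ∈ extend n u → dropLarge n w ≡ u
dropLarge-extend {n} {u} sp w∈ with ∈-++⁻ (insertions +[1+ n ] u) w∈
... | inj₁ w∈⁺ = dropLarge-insertions n _ u (signedPerm-small sp) ℕₚ.≤-refl w∈⁺
... | inj₂ w∈⁻ = dropLarge-insertions n _ u (signedPerm-small sp) ℕₚ.≤-refl w∈⁻

signedPerms′ : ℕ → List (List ℤ)
signedPerms′ zero    = [] ∷ []
signedPerms′ (suc n) = concatMap (extend n) (signedPerms′ n)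

∈-signedPerms′⁻ : ∀ n {w} → w ∈ signedPerms′ n → SignedPerm n w
∈-signedPerms′⁻ zero    (here refl) = refl , [] , []
∈-signedPerms′⁻ (suc n) w∈
  with u , u∈ , w∈ext ← find (∈-concatMap⁻ (extend n) {xs = signedPerms′ n} w∈)
  with v , ∣v∣≡1+n , w↭v∷u ← ∈-extend⁻ n u w∈ext
  = signedPerm-resp-↭ (↭-sym w↭v∷u) (signedPerm-∷⁺ {v = v} ∣v∣≡1+n (∈-signedPerms′⁻ n u∈))

∈-signedPerms′⁺ : ∀ n {w} → SignedPerm n w → w ∈ signedPerms′ n
∈-signedPerms′⁺ zero    {[]}    _        = here refl
∈-signedPerms′⁺ zero    {_ ∷ _} (() , _)
∈-signedPerms′⁺ (suc n) {w}     sp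
  with v , v∈w , ∣v∣≡1+n ← find (signedPerm-max sp)
  with as , bs , refl ← ∈-∃++ v∈w
  = ∈-concatMap⁺ (extend n) (Any.map (λ { refl → ∈-extend⁺ n as bs ∣v∣≡1+n }) u∈)
  where
  u∈ : as ++ bs ∈ signedPerms′ n
  u∈ = ∈-signedPerms′⁺ n (signedPerm-∷⁻ {v = v} ∣v∣≡1+n (signedPerm-resp-↭ (shift v as bs) sp))

unique-signedPerms′ : ∀ n → Unique (signedPerms′ n)
unique-signedPerms′ zero    = [] ∷ []
unique-signedPerms′ (suc n) = unique-concatMap (extend n) (dropLarge n) (unique-signedPerms′ n)
  (unique-extend ∘ ∈-signedPerms′⁻ n) (dropLarge-extend ∘ ∈-signedPerms′⁻ n)

-- Alternating descents as negative adjacent sums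

negPair : ℤ → ℤ → ℕ
negPair a b = if ⌊ a + b <? + 0 ⌋ then 1 else 0

negSums : ℤ → List ℤ → ℕ
negSums p []       = 0
negSums p (x ∷ xs) = negPair p x ℕ.+ negSums x xs

negPair-comm : ∀ a b → negPair a b ≡ negPair b a
negPair-comm a b = cong (λ c → if ⌊ c <? + 0 ⌋ then 1 else 0) (ℤₚ.+-comm a b)

negPair-0⊎1 : ∀ a b → negPair a b ≡ 0 ⊎ negPair a b ≡ 1
negPair-0⊎1 a b with ⌊ a + b <? + 0 ⌋
... | true  = inj₂ refl
... | false = inj₁ refl

∣a∣≤n⇒a+[1+n]≮0 : ∀ n a → ∣ a ∣ ℕ.≤ n → ¬ (a + +[1+ n ] < + 0)
∣a∣≤n⇒a+[1+n]≮0 n (+ m)    _   (ℤ.+<+ ())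
∣a∣≤n⇒a+[1+n]≮0 n -[1+ m ] m<n rewrite ℤₚ.⊖-≥ {suc n} {suc m} (ℕₚ.m≤n⇒m≤1+n m<n) =
  λ { (ℤ.+<+ ()) }

∣a∣≤n⇒a-[1+n]<0 : ∀ n a → ∣ a ∣ ℕ.≤ n → a + -[1+ n ] < + 0
∣a∣≤n⇒a-[1+n]<0 n (+ m)    m≤n rewrite ℤₚ.⊖-< {m} {suc n} (s≤s m≤n) | ℕₚ.+-∸-assoc 1 m≤n =
  ℤ.-<+
∣a∣≤n⇒a-[1+n]<0 n -[1+ m ] _   = ℤ.-<+

negPair-+[1+n] : ∀ n {a} → ∣ a ∣ ℕ.≤ n → negPair a +[1+ n ] ≡ 0
negPair-+[1+n] n {a} ∣a∣≤n with a + +[1+ n ] <? + 0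
... | yes a+v<0 = ⊥-elim (∣a∣≤n⇒a+[1+n]≮0 n a ∣a∣≤n a+v<0)
... | no _      = refl

negPair--[1+n] : ∀ n {a} → ∣ a ∣ ℕ.≤ n → negPair a -[1+ n ] ≡ 1
negPair--[1+n] n {a} ∣a∣≤n with a + -[1+ n ] <? + 0
... | yes _     = refl
... | no a+v≮0 = ⊥-elim (a+v≮0 (∣a∣≤n⇒a-[1+n]<0 n a ∣a∣≤n))

-- b tells whether the head of the list sits in an odd position.
altNeg : Bool → List ℤ → List ℤ
altNeg b []       = []
altNeg b (x ∷ xs) = (if b then - x else x) ∷ altNeg (not b) xs

altNeg-involutive : ∀ b w → altNeg b (altNeg b w) ≡ w
altNeg-involutive b     []       = refl
altNeg-involutive true  (x ∷ xs) = cong₂ _∷_ (ℤₚ.neg-involutive x) (altNeg-involutive false xs)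
altNeg-involutive false (x ∷ xs) = cong (x ∷_) (altNeg-involutive true xs)

altNeg-injective : ∀ b {w w′} → altNeg b w ≡ altNeg b w′ → w ≡ w′
altNeg-injective b {w} {w′} eq =
  trans (sym (altNeg-involutive b w)) (trans (cong (altNeg b) eq) (altNeg-involutive b w′))

map-∣∣-altNeg : ∀ b w → map ∣_∣ (altNeg b w) ≡ map ∣_∣ w
map-∣∣-altNeg b     []       = refl
map-∣∣-altNeg true  (x ∷ xs) = cong₂ _∷_ (ℤₚ.∣-i∣≡∣i∣ x) (map-∣∣-altNeg false xs)
map-∣∣-altNeg false (x ∷ xs) = cong (∣ x ∣ ∷_) (map-∣∣-altNeg true xs)

signedPerm-altNeg : ∀ b {n w} → SignedPerm n w → SignedPerm n (altNeg b w)
signedPerm-altNeg b {n} {w} (len , w∈ , w!) =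
  trans length-altNeg len , subst (All (InRange n)) (sym ∣w∣≡) w∈ , subst Unique (sym ∣w∣≡) w!
  where
  ∣w∣≡ = map-∣∣-altNeg b w
  length-altNeg : length (altNeg b w) ≡ length w
  length-altNeg = begin
    length (altNeg b w)          ≡⟨ Listₚ.length-map ∣_∣ (altNeg b w) ⟨
    length (map ∣_∣ (altNeg b w)) ≡⟨ cong length ∣w∣≡ ⟩
    length (map ∣_∣ w)           ≡⟨ Listₚ.length-map ∣_∣ w ⟩
    length w                     ∎

<⇔-<0 : ∀ {a b} → a < b ⇔ a - b < + 0
<⇔-<0 {a} {b} = mk⇔
  (λ a<b → subst (a - b <_) (ℤₚ.+-inverseʳ b) (ℤₚ.+-monoˡ-< (- b) a<b))
  (λ a-b<0 → subst₂ _<_ (cancel a b) (ℤₚ.+-identityˡ b) (ℤₚ.+-monoˡ-< b a-b<0))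
  where
  cancel : ∀ a b → a - b + b ≡ a
  cancel = solve-∀

isYes-<-<0 : ∀ a b → ⌊ a <? b ⌋ ≡ ⌊ a - b <? + 0 ⌋
isYes-<-<0 a b =
  trans (isYes≗does _) (trans (does-⇔ <⇔-<0 (a <? b) (a - b <? + 0)) (sym (isYes≗does _)))

if-suc≡if-1+ : ∀ {c c′} m → c ≡ c′ → (if c then suc else (λ k → k)) m ≡ (if c′ then 1 else 0) ℕ.+ m
if-suc≡if-1+ {true}  m refl = refl
if-suc≡if-1+ {false} m refl = refl

altdesAux≡negSums : ∀ b p w → altdesAux b p w ≡ negSums (if b then p else - p) (altNeg b w)
altdesAux≡negSums b     p []       = refl
altdesAux≡negSums true  p (x ∷ xs) = trans
  (if-suc≡if-1+ (altdesAux false x xs) (isYes-<-<0 p x))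
  (cong (negPair p (- x) ℕ.+_) (altdesAux≡negSums false x xs))
altdesAux≡negSums false p (x ∷ xs) = trans
  (if-suc≡if-1+ (altdesAux true x xs)
    (trans (isYes-<-<0 x p) (cong (λ c → ⌊ c <? + 0 ⌋) (ℤₚ.+-comm x (- p)))))
  (cong (negPair (- p) x ℕ.+_) (altdesAux≡negSums true x xs))

δ : ℤ → ℤ
δ (+ zero) = + 1
δ _        = + 0

δ-≢0 : ∀ {a} → a ≢ + 0 → δ a ≡ + 0
δ-≢0 {+ zero}    a≢0 = ⊥-elim (a≢0 refl)
δ-≢0 {+[1+ _ ]}  _   = refl
δ-≢0 { -[1+ _ ]} _   = refl

*-δ : ∀ (c : ℤ → ℤ) a b → c a * δ (a - b) ≡ c b * δ (a - b)
*-δ c a b with a ≟ b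
... | yes refl = refl
... | no a≢b rewrite δ-≢0 (a≢b ∘ ℤₚ.i-j≡0⇒i≡j a b) =
  trans (ℤₚ.*-zeroʳ (c a)) (sym (ℤₚ.*-zeroʳ (c b)))

count : (List ℤ → ℕ) → ℤ → List (List ℤ) → ℤ
count f k ws = + length (filter (λ w → + f w ≟ k) ws)

count-∷ : ∀ f k w ws → count f k (w ∷ ws) ≡ δ (+ f w - k) + count f k ws
count-∷ f k w ws with + f w ≟ k
... | yes refl = cong (λ a → δ a + count f k ws) (sym (ℤₚ.+-inverseʳ (+ f w)))
... | no fw≢k  = sym (begin
  δ (+ f w - k) + count f k ws  ≡⟨ cong (_+ count f k ws) (δ-≢0 (fw≢k ∘ ℤₚ.i-j≡0⇒i≡j _ _)) ⟩
  + 0 + count f k ws            ≡⟨ ℤₚ.+-identityˡ _ ⟩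
  count f k ws                  ∎)

count-++ : ∀ f k xs ys → count f k (xs ++ ys) ≡ count f k xs + count f k ys
count-++ f k xs ys = begin
  + length (filter P? (xs ++ ys))
    ≡⟨ cong (+_ ∘ length) (Listₚ.filter-++ P? xs ys) ⟩
  + length (filter P? xs ++ filter P? ys)
    ≡⟨ cong +_ (Listₚ.length-++ (filter P? xs)) ⟩
  + (length (filter P? xs) ℕ.+ length (filter P? ys))
    ≡⟨ ℤₚ.pos-+ (length (filter P? xs)) _ ⟩
  count f k xs + count f k ys ∎
  where P? = λ w → + f w ≟ k

count-↭ : ∀ f k {xs ys} → xs ↭ ys → count f k xs ≡ count f k ys
count-↭ f k xs↭ys = cong +_ (↭-length (filter-↭ (λ w → + f w ≟ k) xs↭ys))

count-map : ∀ f (h : List ℤ → List ℤ) k ws → count f k (map h ws) ≡ count (f ∘ h) k ws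
count-map f h k []       = refl
count-map f h k (w ∷ ws) = begin
  count f k (h w ∷ map h ws)                ≡⟨ count-∷ f k (h w) (map h ws) ⟩
  δ (+ f (h w) - k) + count f k (map h ws)  ≡⟨ cong (λ c → δ (+ f (h w) - k) + c) (count-map f h k ws) ⟩
  δ (+ f (h w) - k) + count (f ∘ h) k ws    ≡⟨ count-∷ (f ∘ h) k w ws ⟨
  count (f ∘ h) k (w ∷ ws)                  ∎

count-cong : ∀ f g k l ws → (∀ w → + f w - k ≡ + g w - l) → count f k ws ≡ count g l ws
count-cong f g k l []       _ = refl
count-cong f g k l (w ∷ ws) e = begin
  count f k (w ∷ ws)            ≡⟨ count-∷ f k w ws ⟩
  δ (+ f w - k) + count f k ws  ≡⟨ cong₂ _+_ (cong δ (e w)) (count-cong f g k l ws e) ⟩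
  δ (+ g w - l) + count g l ws  ≡⟨ count-∷ g l w ws ⟨
  count g l (w ∷ ws)            ∎

count-shift : ∀ c f k ws → count (λ w → c ℕ.+ f w) k ws ≡ count f (k - + c) ws
count-shift c f k ws = count-cong _ f k (k - + c) ws λ w → begin
  + (c ℕ.+ f w) - k  ≡⟨ cong (_- k) (ℤₚ.pos-+ c (f w)) ⟩
  + c + + f w - k    ≡⟨ shuffle (+ c) (+ f w) k ⟩
  + f w - (k - + c)  ∎
  where
  shuffle : ∀ c a k → c + a - k ≡ a - (k - c)
  shuffle = solve-∀

-- Inserting v in front of x after p: t says whether the destroyed pair (p, x) was negative.
δ-first-gap : ∀ t → t ≡ 0 ⊎ t ≡ 1 → ∀ S D k →
  δ (S + (S + D) - k) ≡ + t * δ (+ t + D + (S + S - + 1) - k) + (+ 1 - + t) * δ (+ t + D + (S + S) - k)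
δ-first-gap 0 (inj₁ refl) S D k =
  trans (cong δ (shuffle S D k)) (select (δ (+ 0 + D + (S + S - + 1) - k)) (δ (+ 0 + D + (S + S) - k)))
  where
  shuffle : ∀ S D k → S + (S + D) - k ≡ + 0 + D + (S + S) - k
  shuffle = solve-∀
  select : ∀ a b → b ≡ + 0 * a + (+ 1 - + 0) * b
  select = solve-∀
δ-first-gap 1 (inj₂ refl) S D k =
  trans (cong δ (shuffle S D k)) (select (δ (+ 1 + D + (S + S - + 1) - k)) (δ (+ 1 + D + (S + S) - k)))
  where
  shuffle : ∀ S D k → S + (S + D) - k ≡ + 1 + D + (S + S - + 1) - k
  shuffle = solve-∀
  select : ∀ a b → a ≡ + 1 * a + (+ 1 - + 1) * b
  select = solve-∀

-- If v adds s to every pair it forms, inserting it into an interior gap gives d - 1 + 2s or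
-- d + 2s according as the destroyed pair was negative (d of the gaps) or not, and appending
-- it gives d + s.
count-insertions : ∀ {v s} p xs k → All (λ a → negPair a v ≡ s) (p ∷ xs) →
  let d = + negSums p xs; S = + s in
  count (negSums p) k (insertions v xs) ≡
    d * δ (d + (S + S - + 1) - k) + (+ length xs - d) * δ (d + (S + S) - k) + δ (d + S - k)
count-insertions {v} {s} p [] k (pv ∷ []) = begin
  count (negSums p) k ((v ∷ []) ∷ [])
    ≡⟨ count-∷ (negSums p) k (v ∷ []) [] ⟩
  δ (+ (negPair p v ℕ.+ 0) - k) + + 0
    ≡⟨ cong (λ t → δ (+ t - k) + + 0) (trans (ℕₚ.+-identityʳ _) pv) ⟩
  δ (+ s - k) + + 0
    ≡⟨ only-last (δ (+ s - k)) (δ (+ 0 + (+ s + + s - + 1) - k)) (δ (+ 0 + (+ s + + s) - k)) ⟩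
  + 0 * δ (+ 0 + (+ s + + s - + 1) - k) + (+ 0 - + 0) * δ (+ 0 + (+ s + + s) - k) + δ (+ s - k) ∎
  where
  only-last : ∀ c a b → c + + 0 ≡ + 0 * a + (+ 0 - + 0) * b + c
  only-last = solve-∀
count-insertions {v} {s} p (x ∷ xs) k (pv ∷ xs-hyp@(xv ∷ _)) = begin
  count (negSums p) k ((v ∷ x ∷ xs) ∷ map (x ∷_) (insertions v xs))
    ≡⟨ count-∷ (negSums p) k _ _ ⟩
  δ (+ negSums p (v ∷ x ∷ xs) - k) + count (negSums p) k (map (x ∷_) (insertions v xs))
    ≡⟨ cong₂ _+_ first-gap later-gaps ⟩
  (E * A + (+ 1 - E) * B) + (D * A + (L - D) * B + C)
    ≡⟨ regroup E D L A B C ⟩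
  (E + D) * A + (+ 1 + L - (E + D)) * B + C
    ≡⟨ cong (λ e → e * δ (e + (S + S - + 1) - k) + (+ 1 + L - e) * δ (e + (S + S) - k) + δ (e + S - k))
            (ℤₚ.pos-+ t d) ⟨
  + (t ℕ.+ d) * δ (+ (t ℕ.+ d) + (S + S - + 1) - k)
    + (+ 1 + L - + (t ℕ.+ d)) * δ (+ (t ℕ.+ d) + (S + S) - k) + δ (+ (t ℕ.+ d) + S - k) ∎
  where
  t = negPair p x
  d = negSums x xs
  E = + t
  D = + d
  S = + s
  L = + length xs
  A = δ (E + D + (S + S - + 1) - k)
  B = δ (E + D + (S + S) - k)
  C = δ (E + D + S - k)

  regroup : ∀ E D L A B C →
    (E * A + (+ 1 - E) * B) + (D * A + (L - D) * B + C) ≡ (E + D) * A + (+ 1 + L - (E + D)) * B + C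
  regroup = solve-∀

  first-gap : δ (+ negSums p (v ∷ x ∷ xs) - k) ≡ E * A + (+ 1 - E) * B
  first-gap = begin
    δ (+ (negPair p v ℕ.+ (negPair v x ℕ.+ d)) - k)
      ≡⟨ cong₂ (λ a b → δ (+ (a ℕ.+ (b ℕ.+ d)) - k)) pv (trans (negPair-comm v x) xv) ⟩
    δ (+ (s ℕ.+ (s ℕ.+ d)) - k)
      ≡⟨ cong (λ a → δ (a - k)) (trans (ℤₚ.pos-+ s _) (cong (λ a → S + a) (ℤₚ.pos-+ s d))) ⟩
    δ (S + (S + D) - k)
      ≡⟨ δ-first-gap t (negPair-0⊎1 p x) S D k ⟩
    E * A + (+ 1 - E) * B ∎

  shifted : ∀ c → δ (D + c - (k - E)) ≡ δ (E + D + c - k)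
  shifted c = cong δ (shuffle E D c k)
    where
    shuffle : ∀ E D c k → D + c - (k - E) ≡ E + D + c - k
    shuffle = solve-∀

  later-gaps : count (negSums p) k (map (x ∷_) (insertions v xs)) ≡ D * A + (L - D) * B + C
  later-gaps = begin
    count (negSums p) k (map (x ∷_) (insertions v xs))
      ≡⟨ count-map (negSums p) (x ∷_) k (insertions v xs) ⟩
    count (λ w → t ℕ.+ negSums x w) k (insertions v xs)
      ≡⟨ count-shift t (negSums x) k (insertions v xs) ⟩
    count (negSums x) (k - E) (insertions v xs)
      ≡⟨ count-insertions x xs (k - E) xs-hyp ⟩
    D * δ (D + (S + S - + 1) - (k - E)) + (L - D) * δ (D + (S + S) - (k - E)) + δ (D + S - (k - E))
      ≡⟨ cong₂ _+_ (cong₂ _+_ (cong (D *_) (shifted (S + S - + 1))) (cong ((L - D) *_) (shifted (S + S))))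
                   (shifted S) ⟩
    D * A + (L - D) * B + C ∎

count-extend-δ : ∀ n u k → SignedPerm n u → let D = + negSums (+ 0) u; L = + n in
  count (negSums (+ 0)) k (extend n u) ≡
    D * δ (D - (k + + 1)) + (L - D + + 1) * δ (D - k) + (D + + 1) * δ (D - (k - + 1))
      + (L - D) * δ (D - (k - + 2))
count-extend-δ n u k sp@(refl , _ , _) = begin
  count N k (extend n u)
    ≡⟨ count-++ N k (insertions +[1+ n ] u) _ ⟩
  count N k (insertions +[1+ n ] u) + count N k (insertions -[1+ n ] u)
    ≡⟨ cong₂ _+_ (count-insertions (+ 0) u k (All.map (λ {a} → negPair-+[1+n] n {a}) small))
                 (count-insertions (+ 0) u k (All.map (λ {a} → negPair--[1+n] n {a}) small)) ⟩
  (D * δ (D + (+ 0 + + 0 - + 1) - k) + (L - D) * δ (D + (+ 0 + + 0) - k) + δ (D + + 0 - k))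
    + (D * δ (D + (+ 1 + + 1 - + 1) - k) + (L - D) * δ (D + (+ 1 + + 1) - k) + δ (D + + 1 - k))
    ≡⟨ cong₂ _+_ (cong₃ gaps (cong δ (a≡ D k)) (cong δ (b≡ D k)) (cong δ (b≡′ D k)))
                 (cong₃ gaps (cong δ (c≡ D k)) (cong δ (e≡ D k)) (cong δ (c≡′ D k))) ⟩
  (D * a + (L - D) * b + b) + (D * c + (L - D) * e + c)
    ≡⟨ collect D L a b c e ⟩
  D * a + (L - D + + 1) * b + (D + + 1) * c + (L - D) * e ∎
  where
  N = negSums (+ 0)
  D = + N u
  L = + length u
  small = z≤n ∷ signedPerm-small sp
  a = δ (D - (k + + 1))
  b = δ (D - k)
  c = δ (D - (k - + 1))
  e = δ (D - (k - + 2))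

  gaps : ℤ → ℤ → ℤ → ℤ
  gaps x y z = D * x + (L - D) * y + z
  cong₃ : ∀ (f : ℤ → ℤ → ℤ → ℤ) {x x′ y y′ z z′} → x ≡ x′ → y ≡ y′ → z ≡ z′ → f x y z ≡ f x′ y′ z′
  cong₃ f refl refl refl = refl

  a≡ : ∀ D k → D + (+ 0 + + 0 - + 1) - k ≡ D - (k + + 1)
  a≡ = solve-∀
  b≡ : ∀ D k → D + (+ 0 + + 0) - k ≡ D - k
  b≡ = solve-∀
  b≡′ : ∀ D k → D + + 0 - k ≡ D - k
  b≡′ = solve-∀
  c≡ : ∀ D k → D + (+ 1 + + 1 - + 1) - k ≡ D - (k - + 1)
  c≡ = solve-∀
  c≡′ : ∀ D k → D + + 1 - k ≡ D - (k - + 1)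
  c≡′ = solve-∀
  e≡ : ∀ D k → D + (+ 1 + + 1) - k ≡ D - (k - + 2)
  e≡ = solve-∀

  collect : ∀ D L a b c e → (D * a + (L - D) * b + b) + (D * c + (L - D) * e + c)
    ≡ D * a + (L - D + + 1) * b + (D + + 1) * c + (L - D) * e
  collect = solve-∀

recurrenceRHS : ℕ → ℤ → (ℤ → ℤ) → ℤ
recurrenceRHS n k B =
  (k + + 1) * B (k + + 1) + k * B (k - + 1) + ((+ n) - k + + 1) * B k + ((+ n) - k + + 2) * B (k - + 2)

recurrence-cong : ∀ n k {B B′} → (∀ j → B j ≡ B′ j) → recurrenceRHS n k B ≡ recurrenceRHS n k B′
recurrence-cong n k B≗B′ rewrite B≗B′ (k + + 1) | B≗B′ (k - + 1) | B≗B′ k | B≗B′ (k - + 2) = refl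

recurrence-+ : ∀ n k B B′ →
  recurrenceRHS n k B + recurrenceRHS n k B′ ≡ recurrenceRHS n k (λ j → B j + B′ j)
recurrence-+ n k B B′ = distrib (k + + 1) k (+ n - k + + 1) (+ n - k + + 2)
  (B (k + + 1)) (B (k - + 1)) (B k) (B (k - + 2)) (B′ (k + + 1)) (B′ (k - + 1)) (B′ k) (B′ (k - + 2))
  where
  distrib : ∀ a b c d x y z w x′ y′ z′ w′ →
    (a * x + b * y + c * z + d * w) + (a * x′ + b * y′ + c * z′ + d * w′)
      ≡ a * (x + x′) + b * (y + y′) + c * (z + z′) + d * (w + w′)
  distrib = solve-∀

recurrence-zero : ∀ n k → recurrenceRHS n k (λ _ → + 0) ≡ + 0
recurrence-zero n k = annihilate (k + + 1) k (+ n - k + + 1) (+ n - k + + 2)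
  where
  annihilate : ∀ a b c d → a * + 0 + b * + 0 + c * + 0 + d * + 0 ≡ + 0
  annihilate = solve-∀

recurrence-δ : ∀ n D k →
  D * δ (D - (k + + 1)) + (+ n - D + + 1) * δ (D - k) + (D + + 1) * δ (D - (k - + 1))
    + (+ n - D) * δ (D - (k - + 2))
  ≡ recurrenceRHS n k (λ j → δ (D - j))
recurrence-δ n D k = begin
  D * a + (L - D + + 1) * b + (D + + 1) * c + (L - D) * e
    ≡⟨ cong₂ _+_ (cong₂ _+_ (cong₂ _+_ (*-δ (λ j → j) D (k + + 1)) (*-δ (λ j → L - j + + 1) D k))
                            (*-δ (λ j → j + + 1) D (k - + 1)))
                 (*-δ (λ j → L - j) D (k - + 2)) ⟩
  (k + + 1) * a + (L - k + + 1) * b + (k - + 1 + + 1) * c + (L - (k - + 2)) * e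
    ≡⟨ arrange k L a b c e ⟩
  recurrenceRHS n k (λ j → δ (D - j)) ∎
  where
  L = + n
  a = δ (D - (k + + 1))
  b = δ (D - k)
  c = δ (D - (k - + 1))
  e = δ (D - (k - + 2))
  arrange : ∀ k L a b c e →
    (k + + 1) * a + (L - k + + 1) * b + (k - + 1 + + 1) * c + (L - (k - + 2)) * e
      ≡ (k + + 1) * a + k * c + (L - k + + 1) * b + (L - k + + 2) * e
  arrange = solve-∀

count-concatMap-extend : ∀ n k {us} → All (SignedPerm n) us →
  count (negSums (+ 0)) k (concatMap (extend n) us) ≡ recurrenceRHS n k (λ j → count (negSums (+ 0)) j us)
count-concatMap-extend n k []                  = sym (recurrence-zero n k)
count-concatMap-extend n k {u ∷ us} (sp ∷ sps) = begin
  count N k (extend n u ++ concatMap (extend n) us)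
    ≡⟨ count-++ N k (extend n u) _ ⟩
  count N k (extend n u) + count N k (concatMap (extend n) us)
    ≡⟨ cong₂ _+_ (trans (count-extend-δ n u k sp) (recurrence-δ n (+ N u) k))
                 (count-concatMap-extend n k sps) ⟩
  recurrenceRHS n k (λ j → δ (+ N u - j)) + recurrenceRHS n k (λ j → count N j us)
    ≡⟨ recurrence-+ n k (λ j → δ (+ N u - j)) (λ j → count N j us) ⟩
  recurrenceRHS n k (λ j → δ (+ N u - j) + count N j us)
    ≡⟨ recurrence-cong n k (λ j → count-∷ N j u us) ⟨
  recurrenceRHS n k (λ j → count N j (u ∷ us)) ∎
  where
  N = negSums (+ 0)

altNeg-signedPerms↭ : ∀ n → map (altNeg true) (signedPerms n) ↭ signedPerms′ n
altNeg-signedPerms↭ n = unique∧set⇒↭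
  (Uniqueₚ.map⁺ (altNeg-injective true) (unique-signedPerms n)) (unique-signedPerms′ n) to from
  where
  to : ∀ {w} → w ∈ map (altNeg true) (signedPerms n) → w ∈ signedPerms′ n
  to w∈ with _ , w′∈ , refl ← ∈-map⁻ (altNeg true) w∈ =
    ∈-signedPerms′⁺ n (signedPerm-altNeg true (∈-signedPerms⁻ n w′∈))
  from : ∀ {w} → w ∈ signedPerms′ n → w ∈ map (altNeg true) (signedPerms n)
  from {w} w∈ = subst (_∈ map (altNeg true) (signedPerms n)) (altNeg-involutive true w)
    (∈-map⁺ (altNeg true) (∈-signedPerms⁺ n (signedPerm-altNeg true (∈-signedPerms′⁻ n w∈))))

Bhat≡count-signedPerms′ : ∀ n k → Bhat n k ≡ count (negSums (+ 0)) k (signedPerms′ n)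
Bhat≡count-signedPerms′ n k = begin
  count altdesB k (signedPerms n)
    ≡⟨ count-cong altdesB _ k k (signedPerms n)
         (λ w → cong (λ m → + m - k) (altdesAux≡negSums true (+ 0) w)) ⟩
  count (negSums (+ 0) ∘ altNeg true) k (signedPerms n)
    ≡⟨ count-map (negSums (+ 0)) (altNeg true) k (signedPerms n) ⟨
  count (negSums (+ 0)) k (map (altNeg true) (signedPerms n))
    ≡⟨ count-↭ (negSums (+ 0)) k (altNeg-signedPerms↭ n) ⟩
  count (negSums (+ 0)) k (signedPerms′ n) ∎

mainTheorem3 : (n : ℕ) (k : ℤ) →
    Bhat (suc n) k ≡
      (k + + 1) * Bhat n (k + + 1)
      + k * Bhat n (k - + 1)
      + ((+ n) - k + + 1) * Bhat n k
      + ((+ n) - k + + 2) * Bhat n (k - + 2)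
mainTheorem3 n k = begin
  Bhat (suc n) k
    ≡⟨ Bhat≡count-signedPerms′ (suc n) k ⟩
  count (negSums (+ 0)) k (concatMap (extend n) (signedPerms′ n))
    ≡⟨ count-concatMap-extend n k (All.tabulate (∈-signedPerms′⁻ n)) ⟩
  recurrenceRHS n k (λ j → count (negSums (+ 0)) j (signedPerms′ n))
    ≡⟨ recurrence-cong n k (Bhat≡count-signedPerms′ n) ⟨
  recurrenceRHS n k (Bhat n) ∎
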